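{- Let $M$ be a positive integer and let $[a_1,b_1],\dots,[a_k,b_k],[c_1,d_1],\dots,[c_\ell,d_\ell],[c,d]\subseteq[1,M]$ be integer intervals (with $a_i\le b_i$, $c_j\le d_j$, $c\le d$ positive integers) such that $\left(\bigcup_{i=1}^k[a_i,b_i]\right)\cap[c,d]=\emptyset$. Let $X_1,\dots,X_k,Y_1,\dots,Y_\ell,Y$ be subspaces of $\mathbb{F}^n$ over a field $\mathbb{F}$. Then \[ \left[\sum_{i=1}^k X_i\otimes\Gamma[a_i,b_i]\right]\cap\left[\sum_{j=1}^\ell Y_j\otimes\Gamma[c_j,d_j]+Y\otimes\Gamma[c,d]\right] =\left[\sum_{i=1}^k X_i\otimes\Gamma[a_i,b_i]\right]\cap\left[\sum_{j=1}^\ell Y_j\otimes\Gamma[c_j,d_j]\right]. \]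
   Context: For integers $a\le b$, $[a,b]=\{s\in\mathbb{Z}_{\ge0}: a\le s\le b\}$. For $1\le a\le b\le M$, $\Gamma[a,b]\subseteq\mathbb{F}^M$ is the span of the standard basis vectors $e^{(i)}$ of $\mathbb{F}^M$ with $a\le i\le b$. For $v\in\mathbb{F}^n$, $w\in\mathbb{F}^m$, the Kronecker product is $v\otimes w=(w_1v,w_2v,\dots,w_mv)\in\mathbb{F}^{nm}$. For subspaces $V\subseteq\mathbb{F}^n$, $W\subseteq\mathbb{F}^m$ with bases $\{v^{(i)}\}$, $\{w^{(j)}\}$, $V\otimes W\subseteq\mathbb{F}^{nm}$ is the span of all $v^{(i)}\otimes w^{(j)}$. Sums of subspaces denote subspace sums. -}

module Defs where

open import Level using (Level; _⊔_; suc)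
open import Algebra.Bundles using (CommutativeRing)
open import Data.Nat as ℕ using (ℕ; _≤_; _≤?_)
open import Data.Fin as Fin using (Fin; toℕ; remQuot)
open import Data.List using (List; []; _∷_; _++_; map; filter; concatMap)
open import Data.List.Base using (allFin)
open import Data.Product using (Σ; _×_; proj₁; proj₂; _,_)
open import Relation.Nullary using (¬_)
open import Relation.Nullary.Decidable using (_×-dec_)

record Field (c ℓ : Level) : Set (Level.suc (c ⊔ ℓ)) where
  field
    commutativeRing : CommutativeRing c ℓ
  open CommutativeRing commutativeRing public
  field
    1≉0     : ¬ (1# ≈ 0#)
    inverse : ∀ x → ¬ (x ≈ 0#) → Σ Carrier λ y → x * y ≈ 1#

module LinAlg {c ℓ} (F : Field c ℓ) where
  open Field F

  Vector : ℕ → Set c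
  Vector n = Fin n → Carrier

  0ᵥ : ∀ {n} → Vector n
  0ᵥ _ = 0#

  _+ᵥ_ : ∀ {n} → Vector n → Vector n → Vector n
  (u +ᵥ v) i = u i + v i

  _·ᵥ_ : ∀ {n} → Carrier → Vector n → Vector n
  (a ·ᵥ v) i = a * v i

  _≈ᵥ_ : ∀ {n} → Vector n → Vector n → Set ℓ
  u ≈ᵥ v = ∀ i → u i ≈ v i

  data InSpan {n : ℕ} : List (Vector n) → Vector n → Set (c ⊔ ℓ) where
    span-[] : ∀ {v} → v ≈ᵥ 0ᵥ → InSpan [] v
    span-∷  : ∀ {g gs v} (a : Carrier) (w : Vector n) →
              InSpan gs w → v ≈ᵥ ((a ·ᵥ g) +ᵥ w) → InSpan (g ∷ gs) v

  -- A subspace of F^n is represented by a finite spanning list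
  -- (a basis, or any generating family); it denotes the span.
  Subspace : ℕ → Set c
  Subspace n = List (Vector n)

  _∈_ : ∀ {n} → Vector n → Subspace n → Set (c ⊔ ℓ)
  v ∈ X = InSpan X v

  _⊕_ : ∀ {n} → Subspace n → Subspace n → Subspace n
  X ⊕ Y = X ++ Y

  ⨁ : ∀ {n k} → (Fin k → Subspace n) → Subspace n
  ⨁ {k = ℕ.zero}  X = []
  ⨁ {k = ℕ.suc k} X = X Fin.zero ⊕ ⨁ (λ i → X (Fin.suc i))

  e : ∀ {M} → Fin M → Vector M
  e i j with i Fin.≟ j
  ... | Relation.Nullary.yes _ = 1#
  ... | Relation.Nullary.no  _ = 0#

  -- Γ[a,b] ⊆ F^M, 1-based: span of e^(s) for a ≤ s ≤ b (s = toℕ i + 1)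
  Γ : (M a b : ℕ) → Subspace M
  Γ M a b = map e (filter (λ i → (a ≤? ℕ.suc (toℕ i)) ×-dec (ℕ.suc (toℕ i) ≤? b)) (allFin M))

  -- Kronecker product v ⊗ w = (w₁ v, …, w_m v) ∈ F^{m·n}:
  -- entry at position j·n + i (j : Fin m, i : Fin n) is w_j v_i
  _⊗ᵥ_ : ∀ {n m} → Vector n → Vector m → Vector (m ℕ.* n)
  _⊗ᵥ_ {n} {m} v w k = w (proj₁ (remQuot {m} n k)) * v (proj₂ (remQuot {m} n k))

  _⊗_ : ∀ {n m} → Subspace n → Subspace m → Subspace (m ℕ.* n)
  V ⊗ W = concatMap (λ v → map (λ w → v ⊗ᵥ w) W) V

  _∈_∩_ : ∀ {n} → Vector n → Subspace n → Subspace n → Set (c ⊔ ℓ)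
  v ∈ X ∩ Y = (v ∈ X) × (v ∈ Y)

{-# OPTIONS --safe #-}
-- Zeroing the coordinates of F^M ⊗ F^n whose block index lies in [c,d] is a
-- linear projection π. It fixes every generator x ⊗ e^(s) of the left-hand sum
-- (s lies outside [c,d] by disjointness), kills every generator of Y ⊗ Γ[c,d],
-- and maps every generator x ⊗ e^(s) of the Y_j-sum either to itself or to 0.
-- So if v = u + w with u in the Y_j-sum and w in Y ⊗ Γ[c,d], and v lies in the
-- left-hand sum, then v = π v = π u + π w = π u, which lies in the Y_j-sum.
module Submission where

open import Defs
open import Data.Nat using (ℕ; _≤_; _<_)
open import Data.Fin using (Fin)
open import Data.Product using (_×_)
open import Data.Empty using (⊥)

open import Data.Bool using (Bool; true; false; if_then_else_)
open import Data.Bool.Properties using (not-¬)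
open import Data.Empty using (⊥-elim)
open import Data.Fin as Fin using (toℕ; remQuot)
open import Data.List using ([]; _∷_; allFin)
open import Data.List.Relation.Unary.All as All using (All; []; _∷_)
open import Data.List.Relation.Unary.All.Properties using (map⁺; ++⁺; all-filter)
open import Data.Nat as ℕ using (_≤?_)
open import Data.Product using (Σ-syntax; _,_; proj₁)
open import Data.Sum using (_⊎_; inj₁; inj₂)
open import Function using (_∘_)
open import Relation.Nullary using (Dec; does; yes; no)
open import Relation.Nullary.Decidable using (_×-dec_; dec-true; dec-false)
open import Relation.Binary.PropositionalEquality as ≡ using (_≡_; _≢_)
import Relation.Binary.Reasoning.Setoid as SetoidReasoning

module Span {c ℓ} (F : Field c ℓ) {m : ℕ} where
  open Field F
  open LinAlg F

  ∈-resp-≈ᵥ : ∀ {X : Subspace m} {u v} → u ∈ X → u ≈ᵥ v → v ∈ X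
  ∈-resp-≈ᵥ (span-[] u≈0) u≈v = span-[] (λ i → trans (sym (u≈v i)) (u≈0 i))
  ∈-resp-≈ᵥ (span-∷ a w w∈ u≈) u≈v = span-∷ a w w∈ (λ i → trans (sym (u≈v i)) (u≈ i))

  0∈ : ∀ (X : Subspace m) {v} → v ≈ᵥ 0ᵥ → v ∈ X
  0∈ []      v≈0 = span-[] v≈0
  0∈ (g ∷ X) v≈0 = span-∷ 0# 0ᵥ (0∈ X (λ _ → refl))
    (λ i → trans (v≈0 i) (sym (trans (+-identityʳ _) (zeroˡ (g i)))))

  ∈-⊕⁺ˡ : ∀ {X : Subspace m} (Y : Subspace m) {v} → v ∈ X → v ∈ (X ⊕ Y)
  ∈-⊕⁺ˡ Y (span-[] v≈0)       = 0∈ Y v≈0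
  ∈-⊕⁺ˡ Y (span-∷ a w w∈ v≈) = span-∷ a w (∈-⊕⁺ˡ Y w∈) v≈

  ∈-⊕⁻ : ∀ (X : Subspace m) {Y v} → v ∈ (X ⊕ Y) →
         Σ[ u ∈ Vector m ] Σ[ w ∈ Vector m ] u ∈ X × w ∈ Y × v ≈ᵥ (u +ᵥ w)
  ∈-⊕⁻ [] {v = v} v∈ = 0ᵥ , v , span-[] (λ _ → refl) , v∈ , (λ i → sym (+-identityˡ (v i)))
  ∈-⊕⁻ (g ∷ X) (span-∷ a w w∈ v≈) with ∈-⊕⁻ X w∈
  ... | u , w′ , u∈ , w′∈ , w≈ =
    (a ·ᵥ g) +ᵥ u , w′ , span-∷ a u u∈ (λ _ → refl) , w′∈ ,
    (λ i → trans (v≈ i) (trans (+-congˡ (w≈ i)) (sym (+-assoc _ _ _))))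

module Projection {c ℓ} (F : Field c ℓ) {m : ℕ} where
  open Field F
  open LinAlg F
  open Span F

  zeroOn : (Fin m → Bool) → Vector m → Vector m
  zeroOn drop v k = if drop k then 0# else v k

  module _ (drop : Fin m → Bool) where
    private
      π : Vector m → Vector m
      π = zeroOn drop

    Fixed Killed FixedOrKilled : Vector m → Set ℓ
    Fixed g         = π g ≈ᵥ g
    Killed g        = π g ≈ᵥ 0ᵥ
    FixedOrKilled g = Fixed g ⊎ Killed g

    zeroOn-cong : ∀ {u v} → u ≈ᵥ v → π u ≈ᵥ π v
    zeroOn-cong u≈v k with drop k
    ... | true  = refl
    ... | false = u≈v k

    zeroOn-0ᵥ : Killed 0ᵥ
    zeroOn-0ᵥ k with drop k
    ... | true  = refl
    ... | false = refl

    zeroOn-+ᵥ : ∀ u v → π (u +ᵥ v) ≈ᵥ (π u +ᵥ π v)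
    zeroOn-+ᵥ u v k with drop k
    ... | true  = sym (+-identityˡ 0#)
    ... | false = refl

    zeroOn-·ᵥ : ∀ a v → π (a ·ᵥ v) ≈ᵥ (a ·ᵥ π v)
    zeroOn-·ᵥ a v k with drop k
    ... | true  = sym (zeroʳ a)
    ... | false = refl

    zeroOn-combination : ∀ a g w → π ((a ·ᵥ g) +ᵥ w) ≈ᵥ ((a ·ᵥ π g) +ᵥ π w)
    zeroOn-combination a g w k = trans (zeroOn-+ᵥ (a ·ᵥ g) w k) (+-congʳ (zeroOn-·ᵥ a g k))

    ∈⇒Fixed : ∀ {X v} → All Fixed X → v ∈ X → Fixed v
    ∈⇒Fixed [] (span-[] v≈0) k = trans (zeroOn-cong v≈0 k) (trans (zeroOn-0ᵥ k) (sym (v≈0 k)))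
    ∈⇒Fixed {g ∷ _} {v} (πg≈g ∷ fixed) (span-∷ a w w∈ v≈) k = begin
      π v k                     ≈⟨ zeroOn-cong v≈ k ⟩
      π ((a ·ᵥ g) +ᵥ w) k       ≈⟨ zeroOn-combination a g w k ⟩
      a * π g k + π w k         ≈⟨ +-cong (*-congˡ (πg≈g k)) (∈⇒Fixed fixed w∈ k) ⟩
      a * g k + w k             ≈⟨ sym (v≈ k) ⟩
      v k                       ∎
      where open SetoidReasoning setoid

    ∈⇒Killed : ∀ {X v} → All Killed X → v ∈ X → Killed v
    ∈⇒Killed [] (span-[] v≈0) k = trans (zeroOn-cong v≈0 k) (zeroOn-0ᵥ k)
    ∈⇒Killed {g ∷ _} {v} (πg≈0 ∷ killed) (span-∷ a w w∈ v≈) k = begin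
      π v k                     ≈⟨ zeroOn-cong v≈ k ⟩
      π ((a ·ᵥ g) +ᵥ w) k       ≈⟨ zeroOn-combination a g w k ⟩
      a * π g k + π w k         ≈⟨ +-cong (trans (*-congˡ (πg≈0 k)) (zeroʳ a)) (∈⇒Killed killed w∈ k) ⟩
      0# + 0#                   ≈⟨ +-identityˡ 0# ⟩
      0#                        ∎
      where open SetoidReasoning setoid

    ∈⇒zeroOn-∈ : ∀ {X v} → All FixedOrKilled X → v ∈ X → π v ∈ X
    ∈⇒zeroOn-∈ [] (span-[] v≈0) = span-[] (λ k → trans (zeroOn-cong v≈0 k) (zeroOn-0ᵥ k))
    ∈⇒zeroOn-∈ {g ∷ _} (g-fixed-or-killed ∷ rest) (span-∷ a w w∈ v≈) =
      span-∷ (coefficient g-fixed-or-killed) (π w) (∈⇒zeroOn-∈ rest w∈)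
        λ k → trans (zeroOn-cong v≈ k)
                (trans (zeroOn-combination a g w k) (+-congʳ (leading-term g-fixed-or-killed k)))
      where
      coefficient : FixedOrKilled g → Carrier
      coefficient (inj₁ _) = a
      coefficient (inj₂ _) = 0#

      leading-term : (h : FixedOrKilled g) → (a ·ᵥ π g) ≈ᵥ (coefficient h ·ᵥ g)
      leading-term (inj₁ πg≈g) k = *-congˡ (πg≈g k)
      leading-term (inj₂ πg≈0) k = trans (*-congˡ (πg≈0 k)) (trans (zeroʳ a) (sym (zeroˡ (g k))))

    ∩-⊕-Killed : ∀ {X Y Z v} → All Fixed X → All FixedOrKilled Y → All Killed Z →
                 v ∈ X ∩ (Y ⊕ Z) → v ∈ X ∩ Y
    ∩-⊕-Killed {Y = Y} {v = v} fixed fixedOrKilled killed (v∈X , v∈Y⊕Z)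
      with ∈-⊕⁻ Y v∈Y⊕Z
    ... | u , w , u∈Y , w∈Z , v≈u+w = v∈X , ∈-resp-≈ᵥ (∈⇒zeroOn-∈ fixedOrKilled u∈Y) πu≈v
      where
      πu≈v : π u ≈ᵥ v
      πu≈v k = begin
        π u k               ≈⟨ sym (+-identityʳ _) ⟩
        π u k + 0#          ≈⟨ +-congˡ (sym (∈⇒Killed killed w∈Z k)) ⟩
        π u k + π w k       ≈⟨ sym (zeroOn-+ᵥ u w k) ⟩
        π (u +ᵥ w) k        ≈⟨ zeroOn-cong (λ i → sym (v≈u+w i)) k ⟩
        π v k               ≈⟨ ∈⇒Fixed fixed v∈X k ⟩
        v k                 ∎
        where open SetoidReasoning setoid

inInterval? : ∀ {M} (c d : ℕ) (i : Fin M) → Dec (c ≤ ℕ.suc (toℕ i) × ℕ.suc (toℕ i) ≤ d)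
inInterval? c d i = (c ≤? ℕ.suc (toℕ i)) ×-dec (ℕ.suc (toℕ i) ≤? d)

module Generators {c ℓ} (F : Field c ℓ) where
  open LinAlg F

  All-⨁ : ∀ {p n} {P : Vector n → Set p} {k} (X : Fin k → Subspace n) →
          (∀ i → All P (X i)) → All P (⨁ X)
  All-⨁ {k = ℕ.zero}  X all = []
  All-⨁ {k = ℕ.suc k} X all = ++⁺ (all Fin.zero) (All-⨁ (X ∘ Fin.suc) (all ∘ Fin.suc))

  All-⊗Γ : ∀ {p n M} {P : Vector (M ℕ.* n) → Set p} (X : Subspace n) (a b : ℕ) →
           (∀ x i → a ≤ ℕ.suc (toℕ i) → ℕ.suc (toℕ i) ≤ b → P (_⊗ᵥ_ {n} {M} x (e i))) →
           All P (X ⊗ Γ M a b)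
  All-⊗Γ []      a b gen = []
  All-⊗Γ {M = M} (x ∷ X) a b gen =
    ++⁺ (map⁺ (map⁺ (All.map (λ {i} (a≤s , s≤b) → gen x i a≤s s≤b)
                             (all-filter (inInterval? a b) (allFin M)))))
        (All-⊗Γ X a b gen)

module Blocks {c ℓ} (F : Field c ℓ) (n M : ℕ) where
  open Field F
  open LinAlg F
  open Projection F

  blockOf : Fin (M ℕ.* n) → Fin M
  blockOf k = proj₁ (remQuot {M} n k)

  e-≢ : ∀ {i j : Fin M} → i ≢ j → e i j ≈ 0#
  e-≢ {i} {j} i≢j with i Fin.≟ j
  ... | yes i≡j = ⊥-elim (i≢j i≡j)
  ... | no  _   = refl

  ⊗ᵥe-outside-block : ∀ (x : Vector n) {i} k → i ≢ blockOf k → (x ⊗ᵥ e i) k ≈ 0#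
  ⊗ᵥe-outside-block x k i≢b = trans (*-congʳ (e-≢ i≢b)) (zeroˡ _)

  ⊗ᵥe-Fixed : ∀ (drop : Fin M → Bool) x i → drop i ≡ false →
              Fixed (drop ∘ blockOf) (_⊗ᵥ_ {n} {M} x (e i))
  ⊗ᵥe-Fixed drop x i dropᵢ≡false k with drop (blockOf k) in dropₖ
  ... | false = refl
  ... | true  = sym (⊗ᵥe-outside-block x k λ i≡b →
                  not-¬ dropₖ (≡.trans (≡.cong drop (≡.sym i≡b)) dropᵢ≡false))

  ⊗ᵥe-Killed : ∀ (drop : Fin M → Bool) x i → drop i ≡ true →
               Killed (drop ∘ blockOf) (_⊗ᵥ_ {n} {M} x (e i))
  ⊗ᵥe-Killed drop x i dropᵢ≡true k with drop (blockOf k) in dropₖ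
  ... | true  = refl
  ... | false = ⊗ᵥe-outside-block x k λ i≡b →
                  not-¬ dropₖ (≡.trans (≡.cong drop (≡.sym i≡b)) dropᵢ≡true)

  ⊗ᵥe-FixedOrKilled : ∀ (drop : Fin M → Bool) x i →
                      FixedOrKilled (drop ∘ blockOf) (_⊗ᵥ_ {n} {M} x (e i))
  ⊗ᵥe-FixedOrKilled drop x i with drop i in dropᵢ
  ... | false = inj₁ (⊗ᵥe-Fixed drop x i dropᵢ)
  ... | true  = inj₂ (⊗ᵥe-Killed drop x i dropᵢ)

lemma1 : ∀ {c ℓ} (F : Field c ℓ) (n M k l : ℕ) → 0 < M →
    (a b : Fin k → ℕ) (cc dd : Fin l → ℕ) (c d : ℕ) →
    (∀ i → 1 ≤ a i × a i ≤ b i × b i ≤ M) →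
    (∀ j → 1 ≤ cc j × cc j ≤ dd j × dd j ≤ M) →
    1 ≤ c × c ≤ d × d ≤ M →
    (∀ i s → a i ≤ s → s ≤ b i → c ≤ s → s ≤ d → ⊥) →
    (X : Fin k → LinAlg.Subspace F n) (Y' : Fin l → LinAlg.Subspace F n) (Y : LinAlg.Subspace F n) →
    (v : LinAlg.Vector F (M Data.Nat.* n)) →
    (LinAlg._∈_∩_ F v
       (LinAlg.⨁ F (λ i → LinAlg._⊗_ F (X i) (LinAlg.Γ F M (a i) (b i))))
       (LinAlg._⊕_ F (LinAlg.⨁ F (λ j → LinAlg._⊗_ F (Y' j) (LinAlg.Γ F M (cc j) (dd j))))
                     (LinAlg._⊗_ F Y (LinAlg.Γ F M c d)))
     → LinAlg._∈_∩_ F v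
       (LinAlg.⨁ F (λ i → LinAlg._⊗_ F (X i) (LinAlg.Γ F M (a i) (b i))))
       (LinAlg.⨁ F (λ j → LinAlg._⊗_ F (Y' j) (LinAlg.Γ F M (cc j) (dd j)))))
    × (LinAlg._∈_∩_ F v
       (LinAlg.⨁ F (λ i → LinAlg._⊗_ F (X i) (LinAlg.Γ F M (a i) (b i))))
       (LinAlg.⨁ F (λ j → LinAlg._⊗_ F (Y' j) (LinAlg.Γ F M (cc j) (dd j))))
     → LinAlg._∈_∩_ F v
       (LinAlg.⨁ F (λ i → LinAlg._⊗_ F (X i) (LinAlg.Γ F M (a i) (b i))))
       (LinAlg._⊕_ F (LinAlg.⨁ F (λ j → LinAlg._⊗_ F (Y' j) (LinAlg.Γ F M (cc j) (dd j))))
                     (LinAlg._⊗_ F Y (LinAlg.Γ F M c d))))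
lemma1 F n M k l _ a b cc dd c d _ _ _ disjoint X Y' Y v = remove-Y⊗Γ , add-Y⊗Γ
  where
  open LinAlg F
  open Span F
  open Projection F
  open Generators F
  open Blocks F n M

  ΣX⊗Γ ΣY′⊗Γ Y⊗Γ : Subspace (M ℕ.* n)
  ΣX⊗Γ  = ⨁ λ i → X i ⊗ Γ M (a i) (b i)
  ΣY′⊗Γ = ⨁ λ j → Y' j ⊗ Γ M (cc j) (dd j)
  Y⊗Γ   = Y ⊗ Γ M c d

  drop : Fin (M ℕ.* n) → Bool
  drop = does ∘ inInterval? c d ∘ blockOf

  ΣX⊗Γ-Fixed : All (Fixed drop) ΣX⊗Γ
  ΣX⊗Γ-Fixed = All-⨁ _ λ i → All-⊗Γ (X i) (a i) (b i) λ x s a≤s s≤b →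
    ⊗ᵥe-Fixed (does ∘ inInterval? c d) x s
      (dec-false (inInterval? c d s) λ (c≤s , s≤d) → disjoint i _ a≤s s≤b c≤s s≤d)

  ΣY′⊗Γ-FixedOrKilled : All (FixedOrKilled drop) ΣY′⊗Γ
  ΣY′⊗Γ-FixedOrKilled = All-⨁ _ λ j → All-⊗Γ (Y' j) (cc j) (dd j) λ x s _ _ →
    ⊗ᵥe-FixedOrKilled (does ∘ inInterval? c d) x s

  Y⊗Γ-Killed : All (Killed drop) Y⊗Γ
  Y⊗Γ-Killed = All-⊗Γ Y c d λ x s c≤s s≤d →
    ⊗ᵥe-Killed (does ∘ inInterval? c d) x s (dec-true (inInterval? c d s) (c≤s , s≤d))

  remove-Y⊗Γ : v ∈ ΣX⊗Γ ∩ (ΣY′⊗Γ ⊕ Y⊗Γ) → v ∈ ΣX⊗Γ ∩ ΣY′⊗Γ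
  remove-Y⊗Γ = ∩-⊕-Killed drop ΣX⊗Γ-Fixed ΣY′⊗Γ-FixedOrKilled Y⊗Γ-Killed

  add-Y⊗Γ : v ∈ ΣX⊗Γ ∩ ΣY′⊗Γ → v ∈ ΣX⊗Γ ∩ (ΣY′⊗Γ ⊕ Y⊗Γ)
  add-Y⊗Γ (v∈ΣX⊗Γ , v∈ΣY′⊗Γ) = v∈ΣX⊗Γ , ∈-⊕⁺ˡ Y⊗Γ v∈ΣY′⊗Γ
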